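{- Let $S$ be a finite set and $P$ a transition matrix on $S$. Let $\tilde S=\{A_1,\dots,A_m\}$ be a partition of $S$ into nonempty sets and $\alpha_1,\dots,\alpha_m$ probability measures on $S$ with $\alpha_i(s)=0$ for $s\notin A_i$ and $\alpha_i(s)>0$ for $s\in A_i$. Assume (Cond1): for all $i,j$ and all $s,s'\in A_j$, $\delta(A_i,s)=\delta(A_i,s')$, where $\delta(A_i,s)=\frac{\sum_{s'\in A_i}\alpha_i(s')P(s',s)}{\alpha_j(s)}$ for $s\in A_j$. Define $\tilde P(A_i,A_j):=\delta(A_i,s)$ for any $s\in A_j$. Then $\tilde P$ is a probability transition matrix on $\tilde S$. -}

module Defs where

open import Level using (Level; _⊔_) renaming (suc to lsuc)
open import Algebra.Bundles using (CommutativeRing)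
open import Relation.Binary.Core using (Rel)
open import Relation.Binary.Structures using (IsTotalOrder)
open import Relation.Nullary using (¬_; does)
open import Relation.Binary.PropositionalEquality using (_≡_)
open import Data.Product using (_×_)
open import Data.Nat using (ℕ)
open import Data.Fin using (Fin; _≟_)
open import Data.Bool using (if_then_else_)
import Algebra.Properties.Monoid.Sum as MonoidSum

-- An ordered field (the scalars; the real numbers are the intended model).
record OrderedField (c ℓ₁ ℓ₂ : Level) : Set (lsuc (c ⊔ ℓ₁ ⊔ ℓ₂)) where
  field
    commutativeRing : CommutativeRing c ℓ₁
  open CommutativeRing commutativeRing public
  field
    _≤_          : Rel Carrier ℓ₂
    isTotalOrder : IsTotalOrder _≈_ _≤_
    +-mono-≤     : ∀ {a b} (z : Carrier) → a ≤ b → (a + z) ≤ (b + z)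
    *-nonneg     : ∀ {a b} → 0# ≤ a → 0# ≤ b → 0# ≤ (a * b)
    0≉1          : ¬ (0# ≈ 1#)
    _⁻¹          : Carrier → Carrier
    ⁻¹-inverse   : ∀ x → ¬ (x ≈ 0#) → (x * (x ⁻¹)) ≈ 1#

  _<_ : Carrier → Carrier → Set (ℓ₁ ⊔ ℓ₂)
  a < b = (a ≤ b) × ¬ (a ≈ b)

  Σ : ∀ {n} → (Fin n → Carrier) → Carrier
  Σ = MonoidSum.sum +-monoid

module _ {c ℓ₁ ℓ₂} (F : OrderedField c ℓ₁ ℓ₂) where
  open OrderedField F

  IsTransitionMatrix : ∀ {n} → (Fin n → Fin n → Carrier) → Set (ℓ₁ ⊔ ℓ₂)
  IsTransitionMatrix {n} P =
    (∀ s t → 0# ≤ P s t) × (∀ s → Σ (λ t → P s t) ≈ 1#)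

  -- Σ_{s ∈ A_i} f s, where A_i = { s | blk s ≡ i }
  ΣIn : ∀ {n m} → (Fin n → Fin m) → Fin m → (Fin n → Carrier) → Carrier
  ΣIn blk i f = Σ (λ s → if does (blk s ≟ i) then f s else 0#)

  δ : ∀ {n m} → (Fin n → Fin n → Carrier) → (Fin n → Fin m) →
      (Fin m → Fin n → Carrier) → Fin m → Fin n → Carrier
  δ P blk α i s = ΣIn blk i (λ s' → α i s' * P s' s) * (α (blk s) s ⁻¹)

-- Row i of P̃ sums to 1 because it is the total mass of the measure α_i P.
-- Since α_j has mass 1 and lives on A_j, where δ(A_i, ·) is constant by
-- (Cond1), P̃(A_i, A_j) = Σ_{s ∈ A_j} α_j(s) δ(A_i, s); summing over j gives
-- Σ_s α_{blk s}(s) δ(A_i, s) = Σ_s (α_i P)(s), and P is stochastic.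
module Submission where

open import Defs
open import Algebra.Bundles using (Monoid)
open import Data.Nat using (ℕ; zero; suc)
open import Data.Fin using (Fin; zero; suc; _≟_)
open import Data.Fin.Properties using (suc-injective)
open import Data.Vec.Functional using (Vector)
open import Data.Product using (_,_; proj₁)
open import Data.Sum using (inj₁; inj₂)
open import Relation.Nullary using (¬_; yes; no; does)
open import Data.Bool using (if_then_else_)
open import Function using (_∘_)
open import Relation.Binary.Bundles using (Poset)
open import Relation.Binary.Structures using (IsTotalOrder)
open import Relation.Binary.PropositionalEquality as ≡ using (_≡_; _≢_)

module MonoidSumProperties {a ℓ} (M : Monoid a ℓ) where
  open Monoid M renaming (_∙_ to _+_; ε to 0#; ∙-cong to +-cong; ∙-congˡ to +-congˡ;
                          identityˡ to +-identityˡ; identityʳ to +-identityʳ)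
  open import Algebra.Properties.Monoid.Sum M using (sum; sum-cong-≋; sum-replicate-zero)

  sum-concentrated : ∀ {n} (f : Vector Carrier n) j →
                     (∀ k → k ≢ j → f k ≈ 0#) → sum f ≈ f j
  sum-concentrated {suc n} f zero f≈0 = trans
    (+-congˡ (trans (sum-cong-≋ (λ k → f≈0 (suc k) λ ())) (sum-replicate-zero n)))
    (+-identityʳ (f zero))
  sum-concentrated {suc n} f (suc j) f≈0 = trans
    (+-cong (f≈0 zero λ ()) (sum-concentrated (λ k → f (suc k)) j
      λ k k≢j → f≈0 (suc k) λ sk≡sj → k≢j (suc-injective sk≡sj)))
    (+-identityˡ (f (suc j)))

module OrderedFieldProperties {c ℓ₁ ℓ₂} (F : OrderedField c ℓ₁ ℓ₂) where
  open OrderedField F hiding (zero)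
  open import Algebra.Properties.Ring ring using (-‿distribˡ-*; -‿distribʳ-*; -‿involutive)
  open IsTotalOrder isTotalOrder using (total)
  open IsTotalOrder isTotalOrder public
    using (≲-respʳ-≈) renaming (refl to ≤-refl; reflexive to ≤-reflexive)

  poset : Poset c ℓ₁ ℓ₂
  poset = record { isPartialOrder = IsTotalOrder.isPartialOrder isTotalOrder }

  open import Relation.Binary.Reasoning.PartialOrder poset

  -x*-x≈x*x : ∀ x → - x * - x ≈ x * x
  -x*-x≈x*x x = begin-equality
    - x * - x     ≈⟨ -‿distribˡ-* x (- x) ⟨
    - (x * - x)   ≈⟨ -‿cong (-‿distribʳ-* x x) ⟨
    - (- (x * x)) ≈⟨ -‿involutive (x * x) ⟩
    x * x         ∎

  x*[y*x⁻¹]≈y : ∀ {x} y → ¬ x ≈ 0# → x * (y * x ⁻¹) ≈ y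
  x*[y*x⁻¹]≈y {x} y x≉0 = begin-equality
    x * (y * x ⁻¹) ≈⟨ *-congˡ (*-comm y (x ⁻¹)) ⟩
    x * (x ⁻¹ * y) ≈⟨ *-assoc x (x ⁻¹) y ⟨
    x * x ⁻¹ * y   ≈⟨ *-congʳ (⁻¹-inverse x x≉0) ⟩
    1# * y         ≈⟨ *-identityˡ y ⟩
    y              ∎

  positive⇒nonzero : ∀ {x} → 0# < x → ¬ x ≈ 0#
  positive⇒nonzero (_ , 0≉x) x≈0 = 0≉x (sym x≈0)

  x≤0⇒0≤-x : ∀ {x} → x ≤ 0# → 0# ≤ (- x)
  x≤0⇒0≤-x {x} x≤0 = begin
    0#       ≈⟨ -‿inverseʳ x ⟨
    x + - x  ≤⟨ +-mono-≤ (- x) x≤0 ⟩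
    0# + - x ≈⟨ +-identityˡ (- x) ⟩
    - x      ∎

  square-nonneg : ∀ x → 0# ≤ (x * x)
  square-nonneg x with total 0# x
  ... | inj₁ 0≤x = *-nonneg 0≤x 0≤x
  ... | inj₂ x≤0 = begin
    0#        ≤⟨ *-nonneg (x≤0⇒0≤-x x≤0) (x≤0⇒0≤-x x≤0) ⟩
    - x * - x ≈⟨ -x*-x≈x*x x ⟩
    x * x     ∎

  -- x⁻¹ = x · (x⁻¹)², a product of nonnegatives.
  ⁻¹-nonneg : ∀ {x} → 0# < x → 0# ≤ (x ⁻¹)
  ⁻¹-nonneg {x} x>0 = begin
    0#                ≤⟨ *-nonneg (proj₁ x>0) (square-nonneg (x ⁻¹)) ⟩
    x * (x ⁻¹ * x ⁻¹) ≈⟨ x*[y*x⁻¹]≈y (x ⁻¹) (positive⇒nonzero x>0) ⟩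
    x ⁻¹              ∎

  +-nonneg : ∀ {x y} → 0# ≤ x → 0# ≤ y → 0# ≤ (x + y)
  +-nonneg {x} {y} 0≤x 0≤y = begin
    0#     ≤⟨ 0≤y ⟩
    y      ≈⟨ +-identityˡ y ⟨
    0# + y ≤⟨ +-mono-≤ y 0≤x ⟩
    x + y  ∎

  Σ-nonneg : ∀ {n} (f : Fin n → Carrier) → (∀ k → 0# ≤ f k) → 0# ≤ Σ f
  Σ-nonneg {zero}  f 0≤f = ≤-refl
  Σ-nonneg {suc n} f 0≤f = +-nonneg (0≤f zero) (Σ-nonneg (λ k → f (suc k)) (λ k → 0≤f (suc k)))

module Lumping {c ℓ₁ ℓ₂} (F : OrderedField c ℓ₁ ℓ₂) where
  open OrderedField F hiding (zero)
  open OrderedFieldProperties F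
  open MonoidSumProperties +-monoid using (sum-concentrated)
  open import Algebra.Properties.Semiring.Sum semiring using (sum-cong-≋; ∑-comm; *-distribˡ-sum)
  open import Relation.Binary.Reasoning.Setoid setoid

  ΣIn-supported : ∀ {n m} (blk : Fin n → Fin m) i (f : Fin n → Carrier) →
                  (∀ s → blk s ≢ i → f s ≈ 0#) → ΣIn F blk i f ≈ Σ f
  ΣIn-supported blk i f f≈0 = sum-cong-≋ restrict
    where
    restrict : ∀ s → (if does (blk s ≟ i) then f s else 0#) ≈ f s
    restrict s with blk s ≟ i
    ... | yes _    = refl
    ... | no  s∉Aᵢ = sym (f≈0 s s∉Aᵢ)

  module Lumped {n m} (P : Fin n → Fin n → Carrier) (blk : Fin n → Fin m)
           (α : Fin m → Fin n → Carrier)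
           (α-supported : ∀ i s → blk s ≢ i → α i s ≈ 0#)
           (α-positive : ∀ i s → blk s ≡ i → 0# < α i s) where

    d : Fin m → Fin n → Carrier
    d = δ F P blk α

    inflow : Fin m → Fin n → Carrier
    inflow i s = Σ (λ s′ → α i s′ * P s′ s)

    αP-supported : ∀ i s s′ → blk s′ ≢ i → α i s′ * P s′ s ≈ 0#
    αP-supported i s s′ s′∉Aᵢ = trans (*-congʳ (α-supported i s′ s′∉Aᵢ)) (zeroˡ (P s′ s))

    α*δ≈inflow : ∀ i s → α (blk s) s * d i s ≈ inflow i s
    α*δ≈inflow i s = trans
      (x*[y*x⁻¹]≈y _ (positive⇒nonzero (α-positive (blk s) s ≡.refl)))
      (ΣIn-supported blk i _ (αP-supported i s))

    δ-nonneg : (∀ s t → 0# ≤ P s t) → ∀ i s → 0# ≤ d i s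
    δ-nonneg P-nonneg i s = *-nonneg
      (≲-respʳ-≈ (sym (ΣIn-supported blk i _ (αP-supported i s)))
        (Σ-nonneg _ λ s′ → *-nonneg (α-nonneg i s′) (P-nonneg s′ s)))
      (⁻¹-nonneg (α-positive (blk s) s ≡.refl))
      where
      α-nonneg : ∀ i s → 0# ≤ α i s
      α-nonneg i s with blk s ≟ i
      ... | yes s∈Aᵢ = proj₁ (α-positive i s s∈Aᵢ)
      ... | no  s∉Aᵢ = ≤-reflexive (sym (α-supported i s s∉Aᵢ))

    δ-ConstantOnBlocks : Set ℓ₁
    δ-ConstantOnBlocks = ∀ i j s s′ → blk s ≡ j → blk s′ ≡ j → d i s ≈ d i s′

    Σ-inflow≈Σα : (∀ s → Σ (P s) ≈ 1#) → ∀ i → Σ (inflow i) ≈ Σ (α i)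
    Σ-inflow≈Σα P-stochastic i = begin
      Σ (inflow i)                          ≈⟨ ∑-comm (λ s s′ → α i s′ * P s′ s) ⟩
      Σ (λ s′ → Σ (λ s → α i s′ * P s′ s))  ≈⟨ sum-cong-≋ (λ s′ → *-distribˡ-sum (α i s′) (P s′)) ⟨
      Σ (λ s′ → α i s′ * Σ (P s′))          ≈⟨ sum-cong-≋ (λ s′ → *-congˡ (P-stochastic s′)) ⟩
      Σ (λ s′ → α i s′ * 1#)                ≈⟨ sum-cong-≋ (λ s′ → *-identityʳ (α i s′)) ⟩
      Σ (α i)                               ∎

    Σ-δ-rep≈Σ-inflow : (rep : Fin m → Fin n) → (∀ j → blk (rep j) ≡ j) →
                       (∀ j → Σ (α j) ≈ 1#) → δ-ConstantOnBlocks →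
                       ∀ i → Σ (λ j → d i (rep j)) ≈ Σ (inflow i)
    Σ-δ-rep≈Σ-inflow rep rep-in-block α-mass δ-constant i = begin
      Σ (λ j → d i (rep j))                    ≈⟨ sum-cong-≋ (λ j → *-identityʳ (d i (rep j))) ⟨
      Σ (λ j → d i (rep j) * 1#)               ≈⟨ sum-cong-≋ (λ j → *-congˡ (α-mass j)) ⟨
      Σ (λ j → d i (rep j) * Σ (α j))          ≈⟨ sum-cong-≋ (λ j → *-distribˡ-sum (d i (rep j)) (α j)) ⟩
      Σ (λ j → Σ (λ s → d i (rep j) * α j s))  ≈⟨ sum-cong-≋ (λ j → sum-cong-≋ (move-into-block j)) ⟩
      Σ (λ j → Σ (λ s → α j s * d i s))        ≈⟨ ∑-comm (λ j s → α j s * d i s) ⟩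
      Σ (λ s → Σ (λ j → α j s * d i s))        ≈⟨ sum-cong-≋ (λ s → sum-concentrated _ (blk s) (off-block s)) ⟩
      Σ (λ s → α (blk s) s * d i s)            ≈⟨ sum-cong-≋ (α*δ≈inflow i) ⟩
      Σ (inflow i)                             ∎
      where
      move-into-block : ∀ j s → d i (rep j) * α j s ≈ α j s * d i s
      move-into-block j s with blk s ≟ j
      ... | yes s∈Aⱼ = trans (*-comm _ _) (*-congˡ (δ-constant i j (rep j) s (rep-in-block j) s∈Aⱼ))
      ... | no  s∉Aⱼ = trans (*-congˡ (α-supported j s s∉Aⱼ))
                         (trans (zeroʳ _) (sym (trans (*-congʳ (α-supported j s s∉Aⱼ)) (zeroˡ _))))

      off-block : ∀ s j → j ≢ blk s → α j s * d i s ≈ 0#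
      off-block s j j≢ = trans (*-congʳ (α-supported j s (j≢ ∘ ≡.sym))) (zeroˡ (d i s))

theorem1 : ∀ {c ℓ₁ ℓ₂} (F : OrderedField c ℓ₁ ℓ₂) → let open OrderedField F in
    (n m : ℕ)
    (P : Fin n → Fin n → Carrier) → IsTransitionMatrix F P →
    (blk : Fin n → Fin m) → (rep : Fin m → Fin n) → (∀ j → blk (rep j) ≡ j) →
    (α : Fin m → Fin n → Carrier) →
    (∀ i → Σ (α i) ≈ 1#) →
    (∀ i s → blk s ≢ i → α i s ≈ 0#) →
    (∀ i s → blk s ≡ i → 0# < α i s) →
    (∀ i j s s′ → blk s ≡ j → blk s′ ≡ j → δ F P blk α i s ≈ δ F P blk α i s′) →
    IsTransitionMatrix F (λ i j → δ F P blk α i (rep j))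
theorem1 F n m P (P-nonneg , P-stochastic) blk rep rep-in-block α α-mass α-supported α-positive δ-constant =
  (λ i j → δ-nonneg P-nonneg i (rep j)) , row-sum
  where
  open OrderedField F
  open Lumping F
  open Lumped P blk α α-supported α-positive

  row-sum : ∀ i → Σ (λ j → d i (rep j)) ≈ 1#
  row-sum i = trans (Σ-δ-rep≈Σ-inflow rep rep-in-block α-mass δ-constant i)
                (trans (Σ-inflow≈Σα P-stochastic i) (α-mass i))
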